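{- Let $p$ be an odd prime and $\sim$ a nontrivial equivalence relation on $\mathbb{Z}_p^\times$ such that for $x\neq y$, $x\sim y$ implies $(y-x)\sim(-x)$. Let $S$ be the union of some equivalence class with $\{0\}$. If $x,y$ and $z,w$ are two pairs of distinct elements of $S$ with $x-y=z-w$, then $x=z$ and $y=w$. In other words, $S$ is a modular Golomb ruler.
   Context: A subset $S\subseteq\mathbb{Z}_p$ is a modular Golomb ruler if it contains $0$ and for any $x\neq y$ and $z\neq w$ in $S$ with $x-y=z-w$ one has $x=z$ and $y=w$. An equivalence relation is nontrivial if it has at least two classes. -}

module Defs where

open import Data.Nat using (ℕ; zero; suc; _+_; _∸_; NonZero)
open import Data.Nat.DivMod using (_%_; m%n<n)
open import Data.Fin using (Fin; toℕ; fromℕ<)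
open import Data.Product using (Σ; _×_; _,_; ∃-syntax)
open import Data.Sum using (_⊎_)
open import Relation.Binary.PropositionalEquality using (_≡_; _≢_)
open import Relation.Nullary using (¬_)

-- ℤ_p is modelled as Fin p (residues 0..p-1), with arithmetic mod p.
-- zeroₚ is the residue 0.
zeroₚ : (p : ℕ) .{{_ : NonZero p}} → Fin p
zeroₚ p = fromℕ< (m%n<n 0 p)

subₚ : (p : ℕ) .{{_ : NonZero p}} → Fin p → Fin p → Fin p
subₚ p x y = fromℕ< (m%n<n (toℕ x + (p ∸ toℕ y)) p)

negₚ : (p : ℕ) .{{_ : NonZero p}} → Fin p → Fin p
negₚ p x = subₚ p (zeroₚ p) x

-- x is a unit of ℤ_p (for p prime: x ≠ 0)
Unit : (p : ℕ) .{{_ : NonZero p}} → Fin p → Set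
Unit p x = x ≢ zeroₚ p

-- _∼_ restricted to ℤ_p^× is an equivalence relation
-- (only values on units matter).
record IsUnitEquivalence (p : ℕ) .{{_ : NonZero p}} (_∼_ : Fin p → Fin p → Set) : Set where
  field
    refl∼  : ∀ x → Unit p x → x ∼ x
    sym∼   : ∀ x y → Unit p x → Unit p y → x ∼ y → y ∼ x
    trans∼ : ∀ x y z → Unit p x → Unit p y → Unit p z → x ∼ y → y ∼ z → x ∼ z

Nontrivial : (p : ℕ) .{{_ : NonZero p}} (_∼_ : Fin p → Fin p → Set) → Set
Nontrivial p _∼_ = ∃[ a ] ∃[ b ] (Unit p a × Unit p b × ¬ (a ∼ b))

InS : (p : ℕ) .{{_ : NonZero p}} (_∼_ : Fin p → Fin p → Set) (c : Fin p) → Fin p → Set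
InS p _∼_ c x = x ≡ zeroₚ p ⊎ (Unit p x × x ∼ c)

IsModularGolombRuler : (p : ℕ) .{{_ : NonZero p}} → (Fin p → Set) → Set
IsModularGolombRuler p S =
  S (zeroₚ p) ×
  (∀ x y z w → S x → S y → S z → S w → x ≢ y → z ≢ w →
     subₚ p x y ≡ subₚ p z w → (x ≡ z × y ≡ w))

module Submission where

-- If some unit u satisfied u ∼ -u, then the class of u together with 0
-- would be closed under t ↦ t - u (for t ∼ u, t ≠ u the hypothesis gives t - u ∼ -u ∼ u); as u
-- generates ℤ_p, every unit would lie in the class of u, against nontriviality. A collision
-- x - y = z - w in S with x ≠ z produces such a u: since b - d ∼ -d for b, d ∈ S with d ≠ 0, b ≠ d,
--   x - y = z - w ∼ -w ∼ y - w = x - z ∼ -z ∼ w - z = y - x = -(x - y)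
-- when z, w ≠ 0, while if z = 0 then x ∼ w = y - x ∼ -x (symmetrically if w = 0).

open import Defs
open import Algebra.Properties.CommutativeSemigroup as CommutativeSemigroupProperties using ()
open import Data.Empty using (⊥-elim)
open import Data.Fin using (Fin; toℕ; _≟_)
open import Data.Fin.Properties using (toℕ-fromℕ<; toℕ-injective; toℕ<n)
open import Data.Nat using (ℕ; NonZero; _+_; _*_; _∸_; _<_; zero; suc; >-nonZero; >-nonZero⁻¹)
open import Data.Nat.Coprimality using (prime⇒coprime; coprime-Bézout)
open import Data.Nat.DivMod
  using (_%_; %-distribˡ-+; %-distribˡ-*; m%n%n≡m%n; m%n≤n; n%n≡0; m*n%n≡0; m<n⇒m%n≡m;
         [m+n]%n≡m%n; [m+kn]%n≡m%n)
open import Data.Nat.GCD using (module Bézout)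
open import Data.Nat.GeneralisedArithmetic using (iterate)
open import Data.Nat.Primality using (Prime)
open import Data.Nat.Properties
  using (+-assoc; +-comm; +-identityʳ; *-identityˡ; +-commutativeSemigroup; *-commutativeSemigroup;
         m∸n+n≡m; m+[n∸m]≡n; <⇒≤; n≢0⇒n>0; m<n⇒0<n∸m; ∸-monoʳ-<)
open import Data.Nat.Tactic.RingSolver using (solve-∀)
open import Data.Product using (_×_; _,_; proj₁; proj₂; ∃-syntax)
open import Data.Sum using (_⊎_; inj₁; inj₂)
open import Function using (_∘_)
open import Relation.Binary.Bundles using (Setoid; PartialSetoid)
import Relation.Binary.Construct.On as On
open import Relation.Binary.PropositionalEquality as ≡ using (_≡_; _≢_; cong)
open import Relation.Nullary using (¬_; yes; no)

module Residues (p : ℕ) .{{_ : NonZero p}} where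

  ≋-setoid : Setoid _ _
  ≋-setoid = On.setoid (≡.setoid ℕ) (_% p)

  open Setoid ≋-setoid public using () renaming (_≈_ to _≋_)
  open Setoid ≋-setoid using (refl; reflexive; sym; trans)
  open import Relation.Binary.Reasoning.Setoid ≋-setoid
  open CommutativeSemigroupProperties +-commutativeSemigroup using () renaming (xy∙z≈xz∙y to m+n+o≡m+o+n)
  open CommutativeSemigroupProperties *-commutativeSemigroup using () renaming (xy∙z≈xz∙y to m*n*o≡m*o*n)

  %-≋ : ∀ m → m % p ≋ m
  %-≋ m = m%n%n≡m%n m p

  +-cong : ∀ {a b c d} → a ≋ b → c ≋ d → a + c ≋ b + d
  +-cong {a} {b} {c} {d} a≋b c≋d = ≡.trans (%-distribˡ-+ a c p)
    (≡.trans (≡.cong₂ (λ u v → (u + v) % p) a≋b c≋d) (≡.sym (%-distribˡ-+ b d p)))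

  *-congʳ : ∀ {a b} c → a ≋ b → a * c ≋ b * c
  *-congʳ {a} {b} c a≋b = ≡.trans (%-distribˡ-* a c p)
    (≡.trans (cong (λ u → (u * (c % p)) % p) a≋b) (≡.sym (%-distribˡ-* b c p)))

  +-inverseʳ : ∀ m → m + (p ∸ m % p) ≋ 0
  +-inverseʳ m = begin
    m + (p ∸ m % p)      ≈⟨ +-cong (%-≋ m) refl ⟨
    m % p + (p ∸ m % p)  ≡⟨ m+[n∸m]≡n (m%n≤n m p) ⟩
    p                    ≈⟨ ≡.trans (n%n≡0 p) (≡.sym (m*n%n≡0 0 p)) ⟩
    0                    ∎

  +-cancelʳ : ∀ {a b} c → a + c ≋ b + c → a ≋ b
  +-cancelʳ {a} {b} c eq = begin
    a                  ≡⟨ +-identityʳ a ⟨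
    a + 0              ≈⟨ +-cong refl (+-inverseʳ c) ⟨
    a + (c + c⁻)       ≡⟨ +-assoc a c c⁻ ⟨
    a + c + c⁻         ≈⟨ +-cong eq refl ⟩
    b + c + c⁻         ≡⟨ +-assoc b c c⁻ ⟩
    b + (c + c⁻)       ≈⟨ +-cong refl (+-inverseʳ c) ⟩
    b + 0              ≡⟨ +-identityʳ b ⟩
    b                  ∎
    where c⁻ = p ∸ c % p

  ∃-inverse : Prime p → ∀ m .{{_ : NonZero m}} → m < p → ∃[ j ] j * m ≋ 1
  ∃-inverse isPrime m m<p with coprime-Bézout (prime⇒coprime isPrime m<p)
  ... | Bézout.-+ x y eq = y , (begin
    y * m      ≡⟨ eq ⟨
    1 + x * p  ≈⟨ [m+kn]%n≡m%n 1 x p ⟩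
    1          ∎)
  ... | Bézout.+- x y eq = q * y , (begin
    q * y * m            ≈⟨ [m+n]%n≡m%n (q * y * m) p ⟨
    q * y * m + p        ≡⟨ cong (q * y * m +_) (m∸n+n≡m (>-nonZero⁻¹ p)) ⟨
    q * y * m + (q + 1)  ≡⟨ factor q y m ⟩
    q * (1 + y * m) + 1  ≡⟨ cong (λ t → q * t + 1) eq ⟩
    q * (x * p) + 1      ≡⟨ reorder q x p ⟩
    1 + q * x * p        ≈⟨ [m+kn]%n≡m%n 1 (q * x) p ⟩
    1                    ∎)
    where
    q = p ∸ 1
    factor : ∀ q y m → q * y * m + (q + 1) ≡ q * (1 + y * m) + 1
    factor = solve-∀
    reorder : ∀ q x p → q * (x * p) + 1 ≡ 1 + q * x * p
    reorder = solve-∀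

  ≋⇒≡ : {x y : Fin p} → toℕ x ≋ toℕ y → x ≡ y
  ≋⇒≡ {x} {y} eq = toℕ-injective
    (≡.trans (≡.sym (m<n⇒m%n≡m (toℕ<n x))) (≡.trans eq (m<n⇒m%n≡m (toℕ<n y))))

  toℕ-zeroₚ : toℕ (zeroₚ p) ≡ 0
  toℕ-zeroₚ = ≡.trans (toℕ-fromℕ< _) (m*n%n≡0 0 p)

  toℕ-subₚ : ∀ x y → toℕ (subₚ p x y) ≋ toℕ x + (p ∸ toℕ y)
  toℕ-subₚ x y = ≡.trans (cong (_% p) (toℕ-fromℕ< _)) (%-≋ _)

  subₚ-+ : ∀ x y → toℕ (subₚ p x y) + toℕ y ≋ toℕ x
  subₚ-+ x y = begin
    toℕ (subₚ p x y) + toℕ y     ≈⟨ +-cong (toℕ-subₚ x y) refl ⟩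
    toℕ x + (p ∸ toℕ y) + toℕ y  ≡⟨ +-assoc (toℕ x) _ _ ⟩
    toℕ x + (p ∸ toℕ y + toℕ y)  ≡⟨ cong (toℕ x +_) (m∸n+n≡m (<⇒≤ (toℕ<n y))) ⟩
    toℕ x + p                    ≈⟨ [m+n]%n≡m%n (toℕ x) p ⟩
    toℕ x                        ∎

  subₚ-unique : ∀ x y d → toℕ d + toℕ y ≋ toℕ x → subₚ p x y ≡ d
  subₚ-unique x y d eq = ≋⇒≡ (+-cancelʳ (toℕ y) (trans (subₚ-+ x y) (sym eq)))

  subₚ≡subₚ⇒ : ∀ x y z w → subₚ p x y ≡ subₚ p z w → toℕ x + toℕ w ≋ toℕ z + toℕ y
  subₚ≡subₚ⇒ x y z w eq = begin
    toℕ x + toℕ w                     ≈⟨ +-cong (subₚ-+ x y) refl ⟨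
    toℕ (subₚ p x y) + toℕ y + toℕ w  ≡⟨ m+n+o≡m+o+n _ (toℕ y) (toℕ w) ⟩
    toℕ (subₚ p x y) + toℕ w + toℕ y  ≡⟨ cong (λ d → toℕ d + toℕ w + toℕ y) eq ⟩
    toℕ (subₚ p z w) + toℕ w + toℕ y  ≈⟨ +-cong (subₚ-+ z w) refl ⟩
    toℕ z + toℕ y                     ∎

  subₚ≡subₚ⇐ : ∀ x y z w → toℕ x + toℕ w ≋ toℕ z + toℕ y → subₚ p x y ≡ subₚ p z w
  subₚ≡subₚ⇐ x y z w eq = subₚ-unique x y (subₚ p z w) (+-cancelʳ (toℕ w) (begin
    toℕ (subₚ p z w) + toℕ y + toℕ w  ≡⟨ m+n+o≡m+o+n _ (toℕ y) (toℕ w) ⟩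
    toℕ (subₚ p z w) + toℕ w + toℕ y  ≈⟨ +-cong (subₚ-+ z w) refl ⟩
    toℕ z + toℕ y                     ≈⟨ eq ⟨
    toℕ x + toℕ w                     ∎))

  subₚ-self : ∀ x → subₚ p x x ≡ zeroₚ p
  subₚ-self x = subₚ-unique x x (zeroₚ p) (reflexive (cong (_+ toℕ x) toℕ-zeroₚ))

  subₚ-identityʳ : ∀ x → subₚ p x (zeroₚ p) ≡ x
  subₚ-identityʳ x = subₚ-unique x (zeroₚ p) x
    (reflexive (≡.trans (cong (toℕ x +_) toℕ-zeroₚ) (+-identityʳ (toℕ x))))

  subₚ-cancelʳ : ∀ x y z → subₚ p x y ≡ subₚ p z y → x ≡ z
  subₚ-cancelʳ x y z eq = ≋⇒≡ (+-cancelʳ (toℕ y) (subₚ≡subₚ⇒ x y z y eq))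

  subₚ-cancelˡ : ∀ x y w → subₚ p x y ≡ subₚ p x w → y ≡ w
  subₚ-cancelˡ x y w eq = ≋⇒≡ (+-cancelʳ (toℕ x) (begin
    toℕ y + toℕ x  ≡⟨ +-comm (toℕ y) (toℕ x) ⟩
    toℕ x + toℕ y  ≈⟨ subₚ≡subₚ⇒ x y x w eq ⟨
    toℕ x + toℕ w  ≡⟨ +-comm (toℕ x) (toℕ w) ⟩
    toℕ w + toℕ x  ∎))

  subₚ-exchange : ∀ x y z w → subₚ p x y ≡ subₚ p z w → subₚ p x z ≡ subₚ p y w
  subₚ-exchange x y z w eq = subₚ≡subₚ⇐ x z y w
    (trans (subₚ≡subₚ⇒ x y z w eq) (reflexive (+-comm (toℕ z) (toℕ y))))

  subₚ-flip : ∀ x y z w → subₚ p x y ≡ subₚ p z w → subₚ p y x ≡ subₚ p w z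
  subₚ-flip x y z w eq = subₚ≡subₚ⇐ y x w z (begin
    toℕ y + toℕ z  ≡⟨ +-comm (toℕ y) (toℕ z) ⟩
    toℕ z + toℕ y  ≈⟨ subₚ≡subₚ⇒ x y z w eq ⟨
    toℕ x + toℕ w  ≡⟨ +-comm (toℕ x) (toℕ w) ⟩
    toℕ w + toℕ x  ∎)

  negₚ-subₚ : ∀ x y → negₚ p (subₚ p x y) ≡ subₚ p y x
  negₚ-subₚ x y = subₚ≡subₚ⇐ (zeroₚ p) (subₚ p x y) y x (begin
    toℕ (zeroₚ p) + toℕ x     ≡⟨ cong (_+ toℕ x) toℕ-zeroₚ ⟩
    toℕ x                     ≈⟨ subₚ-+ x y ⟨
    toℕ (subₚ p x y) + toℕ y  ≡⟨ +-comm _ (toℕ y) ⟩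
    toℕ y + toℕ (subₚ p x y)  ∎)

  subₚ≡zeroₚ⇒≡ : ∀ x y → subₚ p x y ≡ zeroₚ p → x ≡ y
  subₚ≡zeroₚ⇒≡ x y eq = subₚ-cancelʳ x y y (≡.trans eq (≡.sym (subₚ-self y)))

  subₚ-unit : ∀ {x y} → x ≢ y → Unit p (subₚ p x y)
  subₚ-unit {x} {y} x≢y = x≢y ∘ subₚ≡zeroₚ⇒≡ x y

  negₚ-unit : ∀ {x} → Unit p x → Unit p (negₚ p x)
  negₚ-unit x≢0 = x≢0 ∘ ≡.sym ∘ subₚ≡zeroₚ⇒≡ (zeroₚ p) _

  toℕ-iterate-subₚ : ∀ u j x →
    toℕ (iterate (λ s → subₚ p s u) x j) ≋ toℕ x + j * (p ∸ toℕ u)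
  toℕ-iterate-subₚ u zero x = reflexive (≡.sym (+-identityʳ (toℕ x)))
  toℕ-iterate-subₚ u (suc j) x = begin
    toℕ (iterate (λ s → subₚ p s u) (subₚ p x u) j)  ≈⟨ toℕ-iterate-subₚ u j (subₚ p x u) ⟩
    toℕ (subₚ p x u) + j * m                         ≈⟨ +-cong (toℕ-subₚ x u) refl ⟩
    toℕ x + m + j * m                                ≡⟨ +-assoc (toℕ x) m (j * m) ⟩
    toℕ x + suc j * m                                ∎
    where m = p ∸ toℕ u

  iterate-subₚ-surjective : Prime p → ∀ {u} → Unit p u →
    ∀ t → ∃[ j ] iterate (λ s → subₚ p s u) (zeroₚ p) j ≡ t
  iterate-subₚ-surjective isPrime {u} u≢0 t = j * toℕ t , ≋⇒≡ (begin
    toℕ (iterate (λ s → subₚ p s u) (zeroₚ p) (j * toℕ t))  ≈⟨ toℕ-iterate-subₚ u (j * toℕ t) (zeroₚ p) ⟩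
    toℕ (zeroₚ p) + j * toℕ t * m                          ≡⟨ cong (_+ j * toℕ t * m) toℕ-zeroₚ ⟩
    j * toℕ t * m                                          ≡⟨ m*n*o≡m*o*n j (toℕ t) m ⟩
    j * m * toℕ t                                          ≈⟨ *-congʳ (toℕ t) j*m≋1 ⟩
    1 * toℕ t                                              ≡⟨ *-identityˡ (toℕ t) ⟩
    toℕ t                                                  ∎)
    where
    m = p ∸ toℕ u
    instance
      m≢0 : NonZero m
      m≢0 = >-nonZero (m<n⇒0<n∸m (toℕ<n u))
    m<p : m < p
    m<p = ∸-monoʳ-< (n≢0⇒n>0 (λ u≡0 → u≢0 (toℕ-injective (≡.trans u≡0 (≡.sym toℕ-zeroₚ)))))
                    (<⇒≤ (toℕ<n u))
    j = proj₁ (∃-inverse isPrime m m<p)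
    j*m≋1 = proj₂ (∃-inverse isPrime m m<p)

  subₚ-induction : Prime p → ∀ {u} → Unit p u → (P : Fin p → Set) →
    P (zeroₚ p) → (∀ t → P t → P (subₚ p t u)) → ∀ t → P t
  subₚ-induction isPrime {u} u≢0 P P0 step t with iterate-subₚ-surjective isPrime u≢0 t
  ... | j , ≡.refl = preserved j P0
    where
    preserved : ∀ j {x} → P x → P (iterate (λ s → subₚ p s u) x j)
    preserved zero    Px = Px
    preserved (suc j) Px = preserved j (step _ Px)

module RelatedUnits {p : ℕ} .{{_ : NonZero p}} {_∼_ : Fin p → Fin p → Set}
  (∼-isUnitEquivalence : IsUnitEquivalence p _∼_) where

  open IsUnitEquivalence ∼-isUnitEquivalence

  infix 4 _≈_
  _≈_ : Fin p → Fin p → Set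
  x ≈ y = Unit p x × Unit p y × x ∼ y

  ≈-refl : ∀ {x} → Unit p x → x ≈ x
  ≈-refl ux = ux , ux , refl∼ _ ux

  ≈-sym : ∀ {x y} → x ≈ y → y ≈ x
  ≈-sym (ux , uy , x∼y) = uy , ux , sym∼ _ _ ux uy x∼y

  ≈-trans : ∀ {x y z} → x ≈ y → y ≈ z → x ≈ z
  ≈-trans (ux , uy , x∼y) (_ , uz , y∼z) = ux , uz , trans∼ _ _ _ ux uy uz x∼y y∼z

  ≈-partialSetoid : PartialSetoid _ _
  ≈-partialSetoid = record
    { _≈_ = _≈_
    ; isPartialEquivalence = record { sym = ≈-sym ; trans = ≈-trans }
    }

module CompatibleRelation {p : ℕ} .{{_ : NonZero p}} (isPrime : Prime p)
  {_∼_ : Fin p → Fin p → Set} (∼-isUnitEquivalence : IsUnitEquivalence p _∼_)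
  (nontrivial : Nontrivial p _∼_)
  (∼-difference : ∀ x y → Unit p x → Unit p y → x ≢ y → x ∼ y → subₚ p y x ∼ negₚ p x)
  where

  open Residues p
  open RelatedUnits ∼-isUnitEquivalence
  open import Relation.Binary.Reasoning.PartialSetoid ≈-partialSetoid

  ≈-difference : ∀ {x y} → x ≈ y → x ≢ y → subₚ p y x ≈ negₚ p x
  ≈-difference (ux , uy , x∼y) x≢y =
    subₚ-unit (x≢y ∘ ≡.sym) , negₚ-unit ux , ∼-difference _ _ ux uy x≢y x∼y

  ≈-negₚ⇒≈-all : ∀ {u} → u ≈ negₚ p u → ∀ t → Unit p t → t ≈ u
  ≈-negₚ⇒≈-all {u} u≈-u t t≢0 =
    unit-in-class (subₚ-induction isPrime (proj₁ u≈-u) ClassOrZero (inj₁ ≡.refl) step t)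
    where
    ClassOrZero : Fin p → Set
    ClassOrZero t = t ≡ zeroₚ p ⊎ t ≈ u
    step : ∀ t → ClassOrZero t → ClassOrZero (subₚ p t u)
    step t (inj₁ ≡.refl) = inj₂ (≈-sym u≈-u)
    step t (inj₂ t≈u) with t ≟ u
    ... | yes ≡.refl = inj₁ (subₚ-self t)
    ... | no t≢u     = inj₂ (≈-trans (≈-difference (≈-sym t≈u) (t≢u ∘ ≡.sym)) (≈-sym u≈-u))
    unit-in-class : ClassOrZero t → t ≈ u
    unit-in-class (inj₁ t≡0) = ⊥-elim (t≢0 t≡0)
    unit-in-class (inj₂ t≈u) = t≈u

  ≉-negₚ : ∀ {u} → ¬ u ≈ negₚ p u
  ≉-negₚ u≈-u = let (a , b , a≢0 , b≢0 , a≁b) = nontrivial in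
    a≁b (proj₂ (proj₂ (≈-trans (≈-negₚ⇒≈-all u≈-u a a≢0) (≈-sym (≈-negₚ⇒≈-all u≈-u b b≢0)))))

  module Ruler (c : Fin p) (c≢0 : Unit p c) where

    S : Fin p → Set
    S = InS p _∼_ c

    S-≈ : ∀ {x y} → S x → S y → x ≢ zeroₚ p → y ≢ zeroₚ p → x ≈ y
    S-≈ sx sy x≢0 y≢0 = ≈-trans (≈-class sx x≢0) (≈-sym (≈-class sy y≢0))
      where
      ≈-class : ∀ {x} → S x → x ≢ zeroₚ p → x ≈ c
      ≈-class (inj₁ x≡0)        x≢0 = ⊥-elim (x≢0 x≡0)
      ≈-class (inj₂ (ux , x∼c)) _   = ux , c≢0 , x∼c

    subₚ-≈-negₚ : ∀ {b d} → S b → S d → d ≢ zeroₚ p → b ≢ d → subₚ p b d ≈ negₚ p d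
    subₚ-≈-negₚ (inj₁ ≡.refl)       _  d≢0 _   = ≈-refl (negₚ-unit d≢0)
    subₚ-≈-negₚ sb@(inj₂ (b≢0 , _)) sd d≢0 b≢d = ≈-difference (S-≈ sd sb d≢0 b≢0) (b≢d ∘ ≡.sym)

    ≢-subₚ : ∀ {a b d} → S a → S b → S d → a ≢ zeroₚ p → d ≢ zeroₚ p → b ≢ d → a ≢ subₚ p b d
    ≢-subₚ {a} {b} {d} sa sb sd a≢0 d≢0 b≢d a≡b-d = ≉-negₚ (begin
      d           ≈⟨ S-≈ sd sa d≢0 a≢0 ⟩
      a           ≡⟨ a≡b-d ⟩
      subₚ p b d  ≈⟨ subₚ-≈-negₚ sb sd d≢0 b≢d ⟩
      negₚ p d    ∎)

    no-collision-off-zero : ∀ {x y z w} → S x → S y → S z → S w →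
      z ≢ zeroₚ p → w ≢ zeroₚ p → x ≢ z → y ≢ w → z ≢ w → subₚ p x y ≢ subₚ p z w
    no-collision-off-zero {x} {y} {z} {w} sx sy sz sw z≢0 w≢0 x≢z y≢w z≢w eq = ≉-negₚ (begin
      subₚ p x y           ≡⟨ eq ⟩
      subₚ p z w           ≈⟨ subₚ-≈-negₚ sz sw w≢0 z≢w ⟩
      negₚ p w             ≈⟨ subₚ-≈-negₚ sy sw w≢0 y≢w ⟨
      subₚ p y w           ≡⟨ subₚ-exchange x y z w eq ⟨
      subₚ p x z           ≈⟨ subₚ-≈-negₚ sx sz z≢0 x≢z ⟩
      negₚ p z             ≈⟨ subₚ-≈-negₚ sw sz z≢0 (z≢w ∘ ≡.sym) ⟨
      subₚ p w z           ≡⟨ subₚ-flip x y z w eq ⟨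
      subₚ p y x           ≡⟨ negₚ-subₚ x y ⟨
      negₚ p (subₚ p x y)  ∎)

    no-collision : ∀ {x y z w} → S x → S y → S z → S w →
      x ≢ y → z ≢ w → x ≢ z → y ≢ w → subₚ p x y ≢ subₚ p z w
    no-collision {x} {y} {z} {w} sx sy sz sw x≢y z≢w x≢z y≢w eq with z ≟ zeroₚ p | w ≟ zeroₚ p
    ... | no z≢0     | no w≢0 = no-collision-off-zero sx sy sz sw z≢0 w≢0 x≢z y≢w z≢w eq
    ... | yes ≡.refl | _      = ≢-subₚ sw sy sx (z≢w ∘ ≡.sym) x≢z (x≢y ∘ ≡.sym)
      (≡.trans (≡.sym (subₚ-identityʳ w)) (≡.sym (subₚ-flip x y z w eq)))
    ... | no _       | yes ≡.refl = ≢-subₚ sz sx sy z≢w y≢w x≢y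
      (≡.trans (≡.sym (subₚ-identityʳ z)) (≡.sym eq))

    isModularGolombRuler : IsModularGolombRuler p S
    isModularGolombRuler = inj₁ ≡.refl , collision-free
      where
      collision-free : ∀ x y z w → S x → S y → S z → S w → x ≢ y → z ≢ w →
        subₚ p x y ≡ subₚ p z w → x ≡ z × y ≡ w
      collision-free x y z w sx sy sz sw x≢y z≢w eq with x ≟ z
      ... | yes ≡.refl = ≡.refl , subₚ-cancelˡ x y w eq
      ... | no x≢z     = ⊥-elim (no-collision sx sy sz sw x≢y z≢w x≢z y≢w eq)
        where
        y≢w : y ≢ w
        y≢w ≡.refl = x≢z (subₚ-cancelʳ x y z eq)

corollary3p21 : (p : ℕ) .{{_ : NonZero p}} → Prime p → p ≢ 2 →
    (_∼_ : Fin p → Fin p → Set) → IsUnitEquivalence p _∼_ → Nontrivial p _∼_ →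
    (∀ x y → Unit p x → Unit p y → x ≢ y → x ∼ y → subₚ p y x ∼ negₚ p x) →
    (c : Fin p) → Unit p c →
    IsModularGolombRuler p (InS p _∼_ c)
corollary3p21 p isPrime _ _∼_ ∼-isUnitEquivalence nontrivial ∼-difference c c≢0 =
  Ruler.isModularGolombRuler c c≢0
  where open CompatibleRelation isPrime ∼-isUnitEquivalence nontrivial ∼-difference
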